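{- For any $0<h<\omega$, any $k\in\omega$ and any $(k,h)$-color $c$, there is a first-order formula $\theta_c(x)$ in one free variable such that for every $h$-forest $\mathcal M$ and every $x\in M$, $\mathcal M\vDash\theta_c(x)$ if and only if the $(k,h)$-color of $x$ in $\mathcal M$ is $c$.
   Context: Let $\mathcal L_0=\{P_i: i\in\omega\}\cup\{<_i:i\in\omega\}$ ($P_i$ unary, $<_i$ binary) and let $T_0$ be the $\mathcal L_0$-theory saying: $P_i\cap P_j=\emptyset$ for $i\ne j$; $<_i\subseteq P_i\times P_{i+1}$; every element of $P_{i+1}$ has a $<_i$-predecessor in $P_i$; $<_i$-predecessors are unique. For $0<h<\omega$ let $\mathcal L_h=\{P_i:i\le h\}\cup\{<_i:i<h\}$; an $h$-forest is the $\mathcal L_h$-reduct of a model of $T_0$. The level of $x$ is the unique $l\le h$ with $P_l(x)$, or $-1$ if there is none. A successor of $x$ is any $y$ with $x<_i y$ for some $i<h$. For $k\in\omega$, the $k$-bounded coloring $\Lambda$ of an $h$-forest assigns to each $x$ the pair $\Lambda(x)=\langle\Lambda_l(x),\Lambda_\sigma(x)\rangle$: $\Lambda_l(x)$ is the level of $x$, and $\Lambda_\sigma(x)$ is the set of pairs $\langle\lambda,n\rangle$ such that $\lambda=\Lambda(y)$ for some successor $y$ of $x$ and $n=\min(k,m)$ where $m$ is the (possibly infinite) number of successors of $x$ with $\Lambda$-value $\lambda$ (defined by downward induction on level; elements with no successors have $\Lambda_\sigma=\emptyset$). A $(k,h)$-color is any value of such a coloring on an element of some $h$-forest; the $(k,h)$-color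 of $x$ is $\Lambda(x)$. -}

module Defs where

open import Data.Nat using (ℕ; zero; suc; _≤_; _<_)
open import Data.Fin using (Fin; zero; suc; toℕ)
open import Data.Maybe using (Maybe; just; nothing)
open import Data.List using (List; []; _∷_)
open import Data.Product using (Σ; ∃; _×_; _,_)
open import Data.Sum using (_⊎_)
open import Data.Empty using (⊥)
open import Data.Unit using (⊤)
open import Relation.Nullary using (¬_)
open import Relation.Binary.PropositionalEquality using (_≡_; _≢_)
open import Function.Bundles using (_⇔_)
open import Function.Definitions using (Injective)

record L0Str (C : Set) : Set₁ where
  field
    P : ℕ → C → Set
    R : ℕ → C → C → Set

record IsT0Model {C : Set} (N : L0Str C) : Set where
  open L0Str N
  field
    disjoint    : ∀ i j → i ≢ j → ∀ x → P i x → P j x → ⊥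
    rel-levels  : ∀ i x y → R i x y → P i x × P (suc i) y
    pred-exists : ∀ i y → P (suc i) y → ∃ λ x → R i x y
    pred-unique : ∀ i x x′ y → R i x y → R i x′ y → x ≡ x′

record LStr (h : ℕ) (C : Set) : Set₁ where
  field
    P : Fin (suc h) → C → Set
    R : Fin h → C → C → Set

IsReductOf : ∀ {h C} → LStr h C → L0Str C → Set
IsReductOf M N =
  (∀ i x → LStr.P M i x ⇔ L0Str.P N (toℕ i) x) ×
  (∀ i x y → LStr.R M i x y ⇔ L0Str.R N (toℕ i) x y)

IsForest : ∀ {h C} → LStr h C → Set₁
IsForest {C = C} M = Σ (L0Str C) λ N → IsT0Model N × IsReductOf M N

-- First-order L_h-formulas with n free variables (de Bruijn, Fin n).

data Formula (h : ℕ) : ℕ → Set where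
  Pf   : ∀ {n} → Fin (suc h) → Fin n → Formula h n
  Rf   : ∀ {n} → Fin h → Fin n → Fin n → Formula h n
  _≐_  : ∀ {n} → Fin n → Fin n → Formula h n
  ⊥f   : ∀ {n} → Formula h n
  ~_   : ∀ {n} → Formula h n → Formula h n
  _∧f_ : ∀ {n} → Formula h n → Formula h n → Formula h n
  _∨f_ : ∀ {n} → Formula h n → Formula h n → Formula h n
  _⇒f_ : ∀ {n} → Formula h n → Formula h n → Formula h n
  ∀f   : ∀ {n} → Formula h (suc n) → Formula h n
  ∃f   : ∀ {n} → Formula h (suc n) → Formula h n

extend : ∀ {C : Set} {n} → (Fin n → C) → C → Fin (suc n) → C
extend ρ x zero    = x
extend ρ x (suc i) = ρ i

⟦_⟧ : ∀ {h n C} → Formula h n → LStr h C → (Fin n → C) → Set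
⟦ Pf i v ⟧    M ρ = LStr.P M i (ρ v)
⟦ Rf i u v ⟧  M ρ = LStr.R M i (ρ u) (ρ v)
⟦ u ≐ v ⟧     M ρ = ρ u ≡ ρ v
⟦ ⊥f ⟧        M ρ = ⊥
⟦ ~ φ ⟧       M ρ = ¬ ⟦ φ ⟧ M ρ
⟦ φ ∧f ψ ⟧    M ρ = ⟦ φ ⟧ M ρ × ⟦ ψ ⟧ M ρ
⟦ φ ∨f ψ ⟧    M ρ = ⟦ φ ⟧ M ρ ⊎ ⟦ ψ ⟧ M ρ
⟦ φ ⇒f ψ ⟧    M ρ = ⟦ φ ⟧ M ρ → ⟦ ψ ⟧ M ρ
⟦ ∀f φ ⟧ M ρ = ∀ x → ⟦ φ ⟧ M (extend ρ x)
⟦ ∃f φ ⟧ M ρ = Σ _ λ x → ⟦ φ ⟧ M (extend ρ x)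

Sat : ∀ {h C} → LStr h C → Formula h 1 → C → Set
Sat M θ x = ⟦ θ ⟧ M (λ _ → x)

-- Levels and successors.  A level is an element of {-1,0,…,h};
-- -1 is represented by nothing, l ≤ h by just l.

Lvl : ℕ → Set
Lvl h = Maybe (Fin (suc h))

LevelIs : ∀ {h C} → LStr h C → C → Lvl h → Set
LevelIs M x (just l) = LStr.P M l x
LevelIs M x nothing  = ∀ l → ¬ LStr.P M l x

Successor : ∀ {h C} → LStr h C → C → C → Set
Successor {h} M x y = Σ (Fin h) λ i → LStr.R M i x y

AtLeast : ∀ {h C} → LStr h C → C → (C → Set) → ℕ → Set
AtLeast {C = C} M x Q n =
  Σ (Fin n → C) λ f → Injective _≡_ _≡_ f × (∀ i → Successor M x (f i) × Q (f i))

-- n = min(k, m) where m (possibly infinite) is the number of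
-- successors of x satisfying Q.
MinCountIs : ∀ {h C} → ℕ → LStr h C → C → (C → Set) → ℕ → Set
MinCountIs k M x Q n = n ≤ k × AtLeast M x Q n × (n < k → ¬ AtLeast M x Q (suc n))

-- A color ⟨level, Λ_σ⟩ is represented by a level and a
-- finite list of pairs ⟨λ, n⟩, the list being read as the finite SET
-- of its entries.

data Color (h : ℕ) : Set where
  col : Lvl h → List (Color h × ℕ) → Color h

mutual
  HasColor : ∀ {h C} → ℕ → LStr h C → C → Color h → Set
  HasColor k M x (col l σ) =
    LevelIs M x l × PairsOK k M x σ × (∀ y → Successor M x y → Covered k M y σ)

  PairsOK : ∀ {h C} → ℕ → LStr h C → C → List (Color h × ℕ) → Set
  PairsOK k M x [] = ⊤
  PairsOK k M x ((c , n) ∷ σ) =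
    (∃ λ y → Successor M x y × HasColor k M y c) ×
    MinCountIs k M x (λ z → HasColor k M z c) n ×
    PairsOK k M x σ

  Covered : ∀ {h C} → ℕ → LStr h C → C → List (Color h × ℕ) → Set
  Covered k M y [] = ⊥
  Covered k M y ((c , n) ∷ σ) = HasColor k M y c ⊎ Covered k M y σ

IsColor : (k h : ℕ) → Color h → Set₁
IsColor k h c =
  Σ Set λ C → Σ (LStr h C) λ M → IsForest M × Σ C λ x → HasColor k M x c

-- The k-bounded color of x is determined by the level of x and, for each
-- color λ occurring among the successors of x, by the number of successors
-- of color λ truncated at k.  Both are first-order conditions once the
-- colors of the successors are, and "at least n successors of color λ" is
-- expressed by n nested existential quantifiers over pairwise distinct
-- successors.  So θ_c is built by recursion on the color term c, and its
-- correctness is proved by the same recursion.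
module Submission where

open import Defs
open import Data.Nat using (ℕ; zero; suc; _<_; _≤?_; _<?_)
open import Data.Fin using (Fin; zero; suc)
open import Data.Maybe using (just; nothing)
open import Data.Fin.Properties using (suc-injective; 0≢1+n)
open import Data.List using (List; []; _∷_; map)
open import Data.List.Properties using (map-∘)
open import Data.List.Membership.Propositional using (_∈_; _∉_)
open import Data.List.Relation.Unary.Any using (here; there)
open import Data.Product using (Σ; ∃; _×_; _,_; proj₁; proj₂)
open import Data.Product.Function.NonDependent.Propositional using (_×-⇔_)
open import Data.Product.Function.Dependent.Propositional using (congˡ)
open import Data.Sum using (inj₁; inj₂)
open import Data.Sum.Function.Propositional using (_⊎-⇔_)
open import Data.Empty using (⊥-elim)
open import Relation.Nullary using (Dec; yes; no)
open import Relation.Binary.PropositionalEquality using (_≡_; refl; sym; cong)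
open import Function.Base using (id)
open import Function.Bundles using (_⇔_; mk⇔; Equivalence)
open import Function.Definitions using (Injective)
open import Function.Properties.Equivalence using ()
  renaming (refl to ⇔-refl; trans to ⇔-trans; sym to ⇔-sym)
open import Function.Related.Propositional using (K-reflexive)
open import Function.Related.TypeIsomorphisms using (→-cong-⇔; ¬-cong-⇔)

Π-cong-⇔ : {A : Set} {B B′ : A → Set} → (∀ x → B x ⇔ B′ x) → (∀ x → B x) ⇔ (∀ x → B′ x)
Π-cong-⇔ B⇔B′ = mk⇔ (λ f x → Equivalence.to (B⇔B′ x) (f x))
                    (λ f x → Equivalence.from (B⇔B′ x) (f x))

Σ-cong-⇔ : {A : Set} {B B′ : A → Set} → (∀ x → B x ⇔ B′ x) → Σ A B ⇔ Σ A B′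
Σ-cong-⇔ B⇔B′ = congˡ λ {x} → B⇔B′ x

Avoiding : {C : Set} → (C → Set) → List C → C → Set
Avoiding Q as z = Q z × z ∉ as

module _ {h : ℕ} {C : Set} (M : LStr h C) where

  AtLeast-mono : ∀ {x} {Q Q′ : C → Set} {m} →
    (∀ {z} → Q z → Q′ z) → AtLeast M x Q m → AtLeast M x Q′ m
  AtLeast-mono Q⇒Q′ (f , f-inj , f-ok) = f , f-inj , λ i → proj₁ (f-ok i) , Q⇒Q′ (proj₂ (f-ok i))

  AtLeast-Avoiding-[] : ∀ {x} {Q : C → Set} {m} → AtLeast M x (Avoiding Q []) m ⇔ AtLeast M x Q m
  AtLeast-Avoiding-[] {Q = Q} =
    mk⇔ (AtLeast-mono {Q = Avoiding Q []} proj₁) (AtLeast-mono {Q′ = Avoiding Q []} λ q → q , λ ())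

  AtLeast-Avoiding-suc : ∀ {x} {Q : C → Set} {as} {m} →
    AtLeast M x (Avoiding Q as) (suc m) ⇔
    ∃ λ y → Successor M x y × Avoiding Q as y × AtLeast M x (Avoiding Q (y ∷ as)) m
  AtLeast-Avoiding-suc {x} {Q} {as} {m} = mk⇔ uncons cons
    where
    uncons : AtLeast M x (Avoiding Q as) (suc m) →
             ∃ λ y → Successor M x y × Avoiding Q as y × AtLeast M x (Avoiding Q (y ∷ as)) m
    uncons (f , f-inj , f-ok) =
      f zero , proj₁ (f-ok zero) , proj₂ (f-ok zero) ,
      (λ i → f (suc i)) , (λ e → suc-injective (f-inj e)) ,
      λ i → let (s , q , ∉as) = f-ok (suc i) in
            s , q , λ { (here e) → 0≢1+n (sym (f-inj e)) ; (there ∈as) → ∉as ∈as }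

    cons : (∃ λ y → Successor M x y × Avoiding Q as y × AtLeast M x (Avoiding Q (y ∷ as)) m) →
           AtLeast M x (Avoiding Q as) (suc m)
    cons (y , y-succ , y-ok , g , g-inj , g-ok) = f , f-inj , f-ok
      where
      f : Fin (suc m) → C
      f zero    = y
      f (suc i) = g i
      f-inj : Injective _≡_ _≡_ f
      f-inj {zero}  {zero}  _ = refl
      f-inj {zero}  {suc j} e = ⊥-elim (proj₂ (proj₂ (g-ok j)) (here (sym e)))
      f-inj {suc i} {zero}  e = ⊥-elim (proj₂ (proj₂ (g-ok i)) (here e))
      f-inj {suc i} {suc j} e = cong suc (g-inj e)
      f-ok : ∀ i → Successor M x (f i) × Avoiding Q as (f i)
      f-ok zero    = y-succ , y-ok
      f-ok (suc i) = let (s , q , ∉y∷as) = g-ok i in s , q , λ ∈as → ∉y∷as (there ∈as)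

OpenFormula : ℕ → Set
OpenFormula h = ∀ {n} → Fin n → Formula h n

module _ {h : ℕ} where

  ⊤f : ∀ {n} → Formula h n
  ⊤f = ⊥f ⇒f ⊥f

  ⋁ : ∀ {n} (m : ℕ) → (Fin m → Formula h n) → Formula h n
  ⋁ zero    F = ⊥f
  ⋁ (suc m) F = F zero ∨f ⋁ m (λ i → F (suc i))

  ⋀ : ∀ {n} (m : ℕ) → (Fin m → Formula h n) → Formula h n
  ⋀ zero    F = ⊤f
  ⋀ (suc m) F = F zero ∧f ⋀ m (λ i → F (suc i))

  isTrue : ∀ {n} {P : Set} → Dec P → Formula h n
  isTrue (yes _) = ⊤f
  isTrue (no _)  = ⊥f

  successorF : ∀ {n} → Fin n → Fin n → Formula h n
  successorF u v = ⋁ h λ i → Rf i u v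

  memberF : ∀ {n} → Fin n → List (Fin n) → Formula h n
  memberF u []       = ⊥f
  memberF u (w ∷ ws) = (u ≐ w) ∨f memberF u ws

  levelF : Lvl h → OpenFormula h
  levelF (just l) v = Pf l v
  levelF nothing  v = ⋀ (suc h) λ l → ~ Pf l v

  someSuccessorF : OpenFormula h → OpenFormula h
  someSuccessorF φ v = ∃f (successorF (suc v) zero ∧f φ zero)

  allSuccessorsF : OpenFormula h → OpenFormula h
  allSuccessorsF φ v = ∀f (successorF (suc v) zero ⇒f φ zero)

  atLeastAvoidingF : OpenFormula h → ℕ → ∀ {n} → Fin n → List (Fin n) → Formula h n
  atLeastAvoidingF φ zero    v ws = ⊤f
  atLeastAvoidingF φ (suc m) v ws =
    ∃f (successorF (suc v) zero ∧f
        ((φ zero ∧f (~ memberF zero (map suc ws))) ∧f atLeastAvoidingF φ m (suc v) (zero ∷ map suc ws)))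

  atLeastF : OpenFormula h → ℕ → OpenFormula h
  atLeastF φ m v = atLeastAvoidingF φ m v []

  minCountF : ℕ → OpenFormula h → ℕ → OpenFormula h
  minCountF k φ m v =
    isTrue (m ≤? k) ∧f (atLeastF φ m v ∧f (isTrue (m <? k) ⇒f (~ atLeastF φ (suc m) v)))

  mutual
    colorF : ℕ → Color h → OpenFormula h
    colorF k (col l σ) v = levelF l v ∧f (pairsF k σ v ∧f allSuccessorsF (coveredF k σ) v)

    pairsF : ℕ → List (Color h × ℕ) → OpenFormula h
    pairsF k []            v = ⊤f
    pairsF k ((c , m) ∷ σ) v =
      someSuccessorF (colorF k c) v ∧f (minCountF k (colorF k c) m v ∧f pairsF k σ v)

    coveredF : ℕ → List (Color h × ℕ) → OpenFormula h
    coveredF k []            v = ⊥f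
    coveredF k ((c , m) ∷ σ) v = colorF k c v ∨f coveredF k σ v

module Semantics {h : ℕ} {C : Set} (M : LStr h C) where

  Expresses : OpenFormula h → (C → Set) → Set
  Expresses φ P = ∀ {n} (ρ : Fin n → C) v → ⟦ φ v ⟧ M ρ ⇔ P (ρ v)

  module _ {n : ℕ} (ρ : Fin n → C) where

    ⟦⋁⟧ : ∀ m (F : Fin m → Formula h n) → ⟦ ⋁ m F ⟧ M ρ ⇔ Σ (Fin m) λ i → ⟦ F i ⟧ M ρ
    ⟦⋁⟧ zero    F = mk⇔ (λ ()) λ ()
    ⟦⋁⟧ (suc m) F = mk⇔ to from
      where
      to : ⟦ ⋁ (suc m) F ⟧ M ρ → Σ (Fin (suc m)) λ i → ⟦ F i ⟧ M ρ
      to (inj₁ p) = zero , p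
      to (inj₂ p) = let (i , q) = Equivalence.to (⟦⋁⟧ m _) p in suc i , q
      from : (Σ (Fin (suc m)) λ i → ⟦ F i ⟧ M ρ) → ⟦ ⋁ (suc m) F ⟧ M ρ
      from (zero  , p) = inj₁ p
      from (suc i , p) = inj₂ (Equivalence.from (⟦⋁⟧ m _) (i , p))

    ⟦⋀⟧ : ∀ m (F : Fin m → Formula h n) → ⟦ ⋀ m F ⟧ M ρ ⇔ (∀ i → ⟦ F i ⟧ M ρ)
    ⟦⋀⟧ zero    F = mk⇔ (λ _ ()) λ _ → id
    ⟦⋀⟧ (suc m) F = mk⇔ to from
      where
      to : ⟦ ⋀ (suc m) F ⟧ M ρ → ∀ i → ⟦ F i ⟧ M ρ
      to (p , ps) zero    = p
      to (p , ps) (suc i) = Equivalence.to (⟦⋀⟧ m _) ps i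
      from : (∀ i → ⟦ F i ⟧ M ρ) → ⟦ ⋀ (suc m) F ⟧ M ρ
      from f = f zero , Equivalence.from (⟦⋀⟧ m _) (λ i → f (suc i))

    ⟦isTrue⟧ : {P : Set} (d : Dec P) → ⟦ isTrue {h} {n} d ⟧ M ρ ⇔ P
    ⟦isTrue⟧ (yes p) = mk⇔ (λ _ → p) λ _ → id
    ⟦isTrue⟧ (no ¬p) = mk⇔ (λ ()) ¬p

    ⟦successorF⟧ : ∀ u v → ⟦ successorF u v ⟧ M ρ ⇔ Successor M (ρ u) (ρ v)
    ⟦successorF⟧ u v = ⟦⋁⟧ h _

    ⟦memberF⟧ : ∀ u ws → ⟦ memberF {h} u ws ⟧ M ρ ⇔ ρ u ∈ map ρ ws
    ⟦memberF⟧ u []       = mk⇔ (λ ()) λ ()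
    ⟦memberF⟧ u (w ∷ ws) = mk⇔ to from
      where
      to : ⟦ memberF u (w ∷ ws) ⟧ M ρ → ρ u ∈ map ρ (w ∷ ws)
      to (inj₁ e) = here e
      to (inj₂ p) = there (Equivalence.to (⟦memberF⟧ u ws) p)
      from : ρ u ∈ map ρ (w ∷ ws) → ⟦ memberF u (w ∷ ws) ⟧ M ρ
      from (here e)  = inj₁ e
      from (there p) = inj₂ (Equivalence.from (⟦memberF⟧ u ws) p)

  levelF-expresses : ∀ l → Expresses (levelF l) (λ x → LevelIs M x l)
  levelF-expresses (just l) ρ v = ⇔-refl
  levelF-expresses nothing  ρ v = ⟦⋀⟧ ρ (suc h) λ l → ~ Pf l v

  module _ {φ : OpenFormula h} {P : C → Set} (φ-expresses : Expresses φ P) where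

    someSuccessorF-expresses : Expresses (someSuccessorF φ) (λ x → ∃ λ y → Successor M x y × P y)
    someSuccessorF-expresses ρ v =
      Σ-cong-⇔ λ y → ⟦successorF⟧ (extend ρ y) (suc v) zero ×-⇔ φ-expresses (extend ρ y) zero

    allSuccessorsF-expresses : Expresses (allSuccessorsF φ) (λ x → ∀ y → Successor M x y → P y)
    allSuccessorsF-expresses ρ v =
      Π-cong-⇔ λ y →
        →-cong-⇔ (⟦successorF⟧ (extend ρ y) (suc v) zero) (φ-expresses (extend ρ y) zero)

    ⟦atLeastAvoidingF⟧ : ∀ m {n} (ρ : Fin n → C) v ws →
      ⟦ atLeastAvoidingF φ m v ws ⟧ M ρ ⇔ AtLeast M (ρ v) (Avoiding P (map ρ ws)) m
    ⟦atLeastAvoidingF⟧ zero    ρ v ws = mk⇔ (λ _ → (λ ()) , (λ { {()} }) , λ ()) λ _ → id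
    ⟦atLeastAvoidingF⟧ (suc m) ρ v ws =
      ⇔-trans (Σ-cong-⇔ λ y →
                 ⟦successorF⟧ (extend ρ y) (suc v) zero ×-⇔
                 ((φ-expresses (extend ρ y) zero ×-⇔ ¬-cong-⇔ (new∈chosen y)) ×-⇔ rest y))
              (⇔-sym (AtLeast-Avoiding-suc M {Q = P}))
      where
      map-extend-suc : ∀ y → map (extend ρ y) (map suc ws) ≡ map ρ ws
      map-extend-suc y = sym (map-∘ ws)

      new∈chosen : ∀ y → ⟦ memberF zero (map suc ws) ⟧ M (extend ρ y) ⇔ y ∈ map ρ ws
      new∈chosen y = ⇔-trans (⟦memberF⟧ (extend ρ y) zero (map suc ws))
                             (K-reflexive (cong (y ∈_) (map-extend-suc y)))

      rest : ∀ y → ⟦ atLeastAvoidingF φ m (suc v) (zero ∷ map suc ws) ⟧ M (extend ρ y) ⇔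
                   AtLeast M (ρ v) (Avoiding P (y ∷ map ρ ws)) m
      rest y = ⇔-trans (⟦atLeastAvoidingF⟧ m (extend ρ y) (suc v) (zero ∷ map suc ws))
                       (K-reflexive (cong (λ as → AtLeast M (ρ v) (Avoiding P (y ∷ as)) m)
                                          (map-extend-suc y)))

    atLeastF-expresses : ∀ m → Expresses (atLeastF φ m) (λ x → AtLeast M x P m)
    atLeastF-expresses m ρ v =
      ⇔-trans (⟦atLeastAvoidingF⟧ m ρ v []) (AtLeast-Avoiding-[] M {Q = P})

    minCountF-expresses : ∀ k m → Expresses (minCountF k φ m) (λ x → MinCountIs k M x P m)
    minCountF-expresses k m ρ v =
      ⟦isTrue⟧ ρ (m ≤? k) ×-⇔ (atLeastF-expresses m ρ v ×-⇔
        →-cong-⇔ (⟦isTrue⟧ ρ (m <? k)) (¬-cong-⇔ (atLeastF-expresses (suc m) ρ v)))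

  module _ (k : ℕ) where
    mutual
      colorF-expresses : ∀ c → Expresses (colorF k c) (λ x → HasColor k M x c)
      colorF-expresses (col l σ) ρ v =
        levelF-expresses l ρ v ×-⇔ (pairsF-expresses σ ρ v ×-⇔
          allSuccessorsF-expresses {coveredF k σ} (coveredF-expresses σ) ρ v)

      pairsF-expresses : ∀ σ → Expresses (pairsF k σ) (λ x → PairsOK k M x σ)
      pairsF-expresses []            ρ v = mk⇔ _ λ _ → id
      pairsF-expresses ((c , m) ∷ σ) ρ v =
        someSuccessorF-expresses {colorF k c} (colorF-expresses c) ρ v ×-⇔
          (minCountF-expresses {colorF k c} {λ x → HasColor k M x c} (colorF-expresses c) k m ρ v
           ×-⇔ pairsF-expresses σ ρ v)

      coveredF-expresses : ∀ σ → Expresses (coveredF k σ) (λ y → Covered k M y σ)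
      coveredF-expresses []            ρ v = mk⇔ id id
      coveredF-expresses ((c , m) ∷ σ) ρ v =
        colorF-expresses c ρ v ⊎-⇔ coveredF-expresses σ ρ v

proposition6p1 : (h : ℕ) → 0 < h → (k : ℕ) → (c : Color h) → IsColor k h c →
    Σ (Formula h 1) λ θ →
    (C : Set) (M : LStr h C) → IsForest M → (x : C) → (Sat M θ x ⇔ HasColor k M x c)
-- θ_c is correct on every L_h-structure, whether or not c is realised and whether or not h > 0.
proposition6p1 h _ k c _ =
  colorF k c zero , λ C M _ x → Semantics.colorF-expresses M k c (λ _ → x) zero
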